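{- Let $n\ge 2$ be an integer and let $(W_r)_{r\in\mathbb{Z}}$ be any generalized $n$-step Fibonacci sequence. Then for every nonnegative integer $k$ and every nonzero complex number $x$, \[ (1-2x+x^{n+1})\sum_{j=0}^{k}x^jW_j=2W_{ -1}-2x^{k+1}W_k+x^{n+1}\sum_{j=k-n}^{k}x^jW_j-x^{n+1}\sum_{j=1}^{n+1}x^{ -j}W_{ -j}. \]
   Context: A generalized $n$-step Fibonacci sequence is any sequence $(W_r)_{r\in\mathbb{Z}}$ of complex numbers satisfying $W_r=\sum_{i=1}^{n}W_{r-i}$ for all $r\in\mathbb{Z}$. -}

module Defs where

open import Level using (Level)
open import Algebra.Bundles using (CommutativeRing)
open import Data.Nat using (ℕ; zero; suc)
open import Data.Integer using (ℤ; +_; -[1+_]) renaming (_+_ to _+ℤ_; _-_ to _-ℤ_; -_ to -ℤ_)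

module Fib {c ℓ : Level} (R : CommutativeRing c ℓ) where
  open CommutativeRing R

  _^_ : Carrier → ℕ → Carrier
  x ^ zero = 1#
  x ^ suc m = x * (x ^ m)

  Σ< : ℕ → (ℕ → Carrier) → Carrier
  Σ< zero f = 0#
  Σ< (suc m) f = Σ< m f + f m

  zpow : Carrier → Carrier → ℤ → Carrier
  zpow x xinv (+ m) = x ^ m
  zpow x xinv -[1+ m ] = xinv ^ suc m

  IsGenFib : ℕ → (ℤ → Carrier) → Set ℓ
  IsGenFib n W = ∀ (r : ℤ) → W r ≈ Σ< n (λ t → W (r -ℤ (+ suc t)))

{-# OPTIONS --safe #-}
module Submission where

open import Defs
open import Level using (Level)
open import Algebra.Bundles using (CommutativeRing)
open import Data.Nat as ℕ using (ℕ; zero; suc; _≤_)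
import Data.Nat.Properties as ℕ
open import Data.Integer as ℤ using (ℤ; +_; -[1+_]; _⊖_; _◃_)
  renaming (_+_ to _+ℤ_; _-_ to _-ℤ_; -_ to -ℤ_)
import Data.Integer.Properties as ℤ
open import Data.Integer.Tactic.RingSolver using (solve-∀)
import Data.Sign as Sign
open import Data.Maybe using (Maybe; map)
open import Relation.Binary.PropositionalEquality as ≡ using (_≡_)
open import Relation.Binary.Consequences using (dec⇒weaklyDec)
open import Algebra.Solver.Ring.AlmostCommutativeRing using (_-Raw-AlmostCommutative⟶_; fromCommutativeRing)

-- Read the right-hand side as a function rhs(k) of k ∈ ℤ; its third term is x^{n+1} times the
-- window Σ_{j=k-n}^{k} x^j W_j. At k = -1 the first two terms cancel and the window is the last
-- sum, so rhs(-1) = 0. Sliding the window from k to k + 1 trades x^{n+1} x^{k-n} W_{k-n} =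
-- x^{k+1} W_{k-n} for x^{n+1} x^{k+1} W_{k+1}, and subtracting consecutive instances of the
-- recurrence gives W_{k-n} = 2 W_k - W_{k+1}; together rhs(k+1) - rhs(k) =
-- (1 - 2x + x^{n+1}) x^{k+1} W_{k+1}, and the identity is the telescoped sum.

-- The ring solver can only cancel terms when equality of coefficients is decidable, so the
-- coefficients are taken in ℤ, which maps into every commutative ring.
module IntegerCoefficients {c ℓ : Level} (R : CommutativeRing c ℓ) where
  open CommutativeRing R
  open import Algebra.Properties.Semiring.Mult.TCOptimised semiring using (_×_; 1+×; ×-homo-+; ×1-homo-*)
  open import Algebra.Properties.Ring ring using (-‿distribˡ-*; -‿distribʳ-*; -0#≈0#; -‿involutive)
  open import Algebra.Properties.AbelianGroup +-abelianGroup using (⁻¹-∙-comm)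
  import Algebra.Solver.CommutativeMonoid +-commutativeMonoid as Monoid
  open import Relation.Binary.Reasoning.Setoid setoid

  fromℤ : ℤ → Carrier
  fromℤ (+ n) = n × 1#
  fromℤ -[1+ n ] = - (suc n × 1#)

  fromℤ-neg : ∀ i → fromℤ (-ℤ i) ≈ - fromℤ i
  fromℤ-neg (+ zero) = sym -0#≈0#
  fromℤ-neg (+ suc n) = refl
  fromℤ-neg -[1+ n ] = sym (-‿involutive _)

  [1+a]-[1+b]≈a-b : ∀ a b → (1# + a) - (1# + b) ≈ a - b
  [1+a]-[1+b]≈a-b a b = begin
    (1# + a) - (1# + b)      ≈⟨ +-congˡ (sym (⁻¹-∙-comm 1# b)) ⟩
    (1# + a) + (- 1# + - b)
      ≈⟨ Monoid.solve 4 (λ o a o′ b → (o ⊕ a) ⊕ (o′ ⊕ b) ⊜ (a ⊕ b) ⊕ (o ⊕ o′)) refl 1# a (- 1#) (- b) ⟩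
    (a - b) + (1# - 1#)      ≈⟨ +-congˡ (-‿inverseʳ 1#) ⟩
    (a - b) + 0#             ≈⟨ +-identityʳ _ ⟩
    a - b                    ∎
    where open Monoid using (_⊕_; _⊜_)

  fromℤ-⊖ : ∀ m n → fromℤ (m ⊖ n) ≈ m × 1# - n × 1#
  fromℤ-⊖ m zero = sym (trans (+-congˡ -0#≈0#) (+-identityʳ _))
  fromℤ-⊖ zero (suc n) = sym (+-identityˡ _)
  fromℤ-⊖ (suc m) (suc n) = begin
    fromℤ (suc m ⊖ suc n)           ≡⟨ ≡.cong fromℤ (ℤ.[1+m]⊖[1+n]≡m⊖n m n) ⟩
    fromℤ (m ⊖ n)                   ≈⟨ fromℤ-⊖ m n ⟩
    m × 1# - n × 1#                 ≈⟨ [1+a]-[1+b]≈a-b _ _ ⟨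
    (1# + m × 1#) - (1# + n × 1#)   ≈⟨ +-cong (1+× m 1#) (-‿cong (1+× n 1#)) ⟨
    suc m × 1# - suc n × 1#         ∎

  fromℤ-+ : ∀ i j → fromℤ (i +ℤ j) ≈ fromℤ i + fromℤ j
  fromℤ-+ (+ m) (+ n) = ×-homo-+ 1# m n
  fromℤ-+ (+ m) -[1+ n ] = fromℤ-⊖ m (suc n)
  fromℤ-+ -[1+ m ] (+ n) = trans (fromℤ-⊖ n (suc m)) (+-comm _ _)
  fromℤ-+ -[1+ m ] -[1+ n ] = begin
    - (suc (suc (m ℕ.+ n)) × 1#)       ≡⟨ ≡.cong (λ k → - (k × 1#)) (ℕ.+-suc (suc m) n) ⟨
    - ((suc m ℕ.+ suc n) × 1#)         ≈⟨ -‿cong (×-homo-+ 1# (suc m) (suc n)) ⟩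
    - (suc m × 1# + suc n × 1#)        ≈⟨ ⁻¹-∙-comm _ _ ⟨
    - (suc m × 1#) + - (suc n × 1#)    ∎

  fromℤ-* : ∀ i j → fromℤ (i ℤ.* j) ≈ fromℤ i * fromℤ j
  fromℤ-* (+ m) (+ n) = begin
    fromℤ (Sign.+ ◃ m ℕ.* n)   ≡⟨ ≡.cong fromℤ (ℤ.+◃n≡+n (m ℕ.* n)) ⟩
    (m ℕ.* n) × 1#             ≈⟨ ×1-homo-* m n ⟩
    m × 1# * n × 1#            ∎
  fromℤ-* (+ m) -[1+ n ] = begin
    fromℤ (Sign.- ◃ m ℕ.* suc n)   ≡⟨ ≡.cong fromℤ (ℤ.-◃n≡-n (m ℕ.* suc n)) ⟩
    fromℤ (-ℤ + (m ℕ.* suc n))     ≈⟨ fromℤ-neg (+ (m ℕ.* suc n)) ⟩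
    - ((m ℕ.* suc n) × 1#)         ≈⟨ -‿cong (×1-homo-* m (suc n)) ⟩
    - (m × 1# * suc n × 1#)        ≈⟨ -‿distribʳ-* _ _ ⟩
    m × 1# * - (suc n × 1#)        ∎
  fromℤ-* -[1+ m ] (+ n) = begin
    fromℤ (Sign.- ◃ suc m ℕ.* n)   ≡⟨ ≡.cong fromℤ (ℤ.-◃n≡-n (suc m ℕ.* n)) ⟩
    fromℤ (-ℤ + (suc m ℕ.* n))     ≈⟨ fromℤ-neg (+ (suc m ℕ.* n)) ⟩
    - ((suc m ℕ.* n) × 1#)         ≈⟨ -‿cong (×1-homo-* (suc m) n) ⟩
    - (suc m × 1# * n × 1#)        ≈⟨ -‿distribˡ-* _ _ ⟩
    - (suc m × 1#) * n × 1#        ∎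
  fromℤ-* -[1+ m ] -[1+ n ] = begin
    (suc m ℕ.* suc n) × 1#           ≈⟨ ×1-homo-* (suc m) (suc n) ⟩
    suc m × 1# * suc n × 1#          ≈⟨ -‿involutive _ ⟨
    - - (suc m × 1# * suc n × 1#)    ≈⟨ -‿cong (-‿distribˡ-* _ _) ⟩
    - (- (suc m × 1#) * suc n × 1#)  ≈⟨ -‿distribʳ-* _ _ ⟩
    - (suc m × 1#) * - (suc n × 1#)  ∎

  fromℤ-homomorphism : ℤ.+-*-rawRing -Raw-AlmostCommutative⟶ fromCommutativeRing R
  fromℤ-homomorphism = record
    { ⟦_⟧    = fromℤ
    ; +-homo = fromℤ-+
    ; *-homo = fromℤ-*
    ; -‿homo = fromℤ-neg
    ; 0-homo = refl
    ; 1-homo = refl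
    }

  fromℤ-≈? : ∀ i j → Maybe (fromℤ i ≈ fromℤ j)
  fromℤ-≈? i j = map (λ { ≡.refl → refl }) (dec⇒weaklyDec ℤ._≟_ i j)

  open import Algebra.Solver.Ring ℤ.+-*-rawRing (fromCommutativeRing R) fromℤ-homomorphism fromℤ-≈? public
    using (solve; _:=_; _:+_; _:*_; _:-_; con)

module _ {c ℓ : Level} (R : CommutativeRing c ℓ) where
  open CommutativeRing R
  open Fib R
  open IntegerCoefficients R
  open import Relation.Binary.Reasoning.Setoid setoid

  two : Carrier
  two = 1# + 1#

  Σ<-cong : ∀ m {f g : ℕ → Carrier} → (∀ t → f t ≈ g t) → Σ< m f ≈ Σ< m g
  Σ<-cong zero f≈g = refl
  Σ<-cong (suc m) f≈g = +-cong (Σ<-cong m f≈g) (f≈g m)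

  Σ<-suc : ∀ m (f : ℕ → Carrier) → Σ< (suc m) f ≈ f 0 + Σ< m (λ t → f (suc t))
  Σ<-suc zero f = +-comm 0# (f 0)
  Σ<-suc (suc m) f = trans (+-congʳ (Σ<-suc m f)) (+-assoc _ _ _)

  Σ<-distribˡ : ∀ m a (f : ℕ → Carrier) → a * Σ< m f ≈ Σ< m (λ t → a * f t)
  Σ<-distribˡ zero a f = zeroʳ a
  Σ<-distribˡ (suc m) a f = trans (distribˡ a _ _) (+-congʳ (Σ<-distribˡ m a f))

  Σ<-telescope : (D u : ℤ → Carrier) → D -[1+ 0 ] ≈ 0# → (∀ k → D (ℤ.suc k) ≈ D k + u (ℤ.suc k)) →
                 ∀ k → Σ< (suc k) (λ j → u (+ j)) ≈ D (+ k)
  Σ<-telescope D u D₋₁≈0 step zero = sym (trans (step -[1+ 0 ]) (+-congʳ D₋₁≈0))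
  Σ<-telescope D u D₋₁≈0 step (suc k) = trans (+-congʳ (Σ<-telescope D u D₋₁≈0 step k)) (sym (step (+ k)))

  window : ℕ → (ℤ → Carrier) → ℤ → Carrier
  window m g a = Σ< m (λ t → g (a +ℤ + t))

  window-suc : ∀ m g a → window (suc m) g a ≈ g a + window m g (ℤ.suc a)
  window-suc m g a = trans (Σ<-suc m _)
    (+-cong (reflexive (≡.cong g (ℤ.+-identityʳ a))) (Σ<-cong m (λ t → reflexive (≡.cong g (shift a (+ t))))))
    where
    shift : ∀ a t → a +ℤ (+ 1 +ℤ t) ≡ (+ 1 +ℤ a) +ℤ t
    shift = solve-∀

  window-slide : ∀ m g a → window (suc m) g (ℤ.suc a) ≈ window (suc m) g a + g (ℤ.suc a +ℤ + m) - g a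
  window-slide m g a = begin
    inner + new
      ≈⟨ solve 3 (λ inner new old → inner :+ new := (old :+ inner) :+ new :- old) refl inner new (g a) ⟩
    (g a + inner) + new - g a      ≈⟨ +-congʳ (+-congʳ (window-suc m g a)) ⟨
    window (suc m) g a + new - g a ∎
    where
    inner new : Carrier
    inner = window m g (ℤ.suc a)
    new = g (ℤ.suc a +ℤ + m)

  Σ<-negatives≈window : ∀ m g → Σ< (suc m) (λ t → g -[1+ t ]) ≈ window (suc m) g -[1+ m ]
  Σ<-negatives≈window zero g = refl
  Σ<-negatives≈window (suc m) g = begin
    Σ< (suc m) (λ t → g -[1+ t ]) + g -[1+ suc m ]  ≈⟨ +-congʳ (Σ<-negatives≈window m g) ⟩
    window (suc m) g -[1+ m ] + g -[1+ suc m ]      ≈⟨ +-comm _ _ ⟩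
    g -[1+ suc m ] + window (suc m) g -[1+ m ]      ≈⟨ window-suc (suc m) g -[1+ suc m ] ⟨
    window (suc (suc m)) g -[1+ suc m ]             ∎

  IsGenFib⇒W[r-n]≈2W[r]-W[1+r] : ∀ m {W} → IsGenFib (suc m) W →
                                 ∀ r → W (r -ℤ + suc m) ≈ two * W r - W (ℤ.suc r)
  IsGenFib⇒W[r-n]≈2W[r]-W[1+r] m {W} fib r = begin
    oldest
      ≈⟨ solve 2 (λ s l → l := con (+ 2) :* (s :+ l) :- (s :+ l :+ s)) refl later oldest ⟩
    two * (later + oldest) - (later + oldest + later)
      ≈⟨ +-cong (*-congˡ (fib r)) (-‿cong (+-congʳ (fib r))) ⟨
    two * W r - (W r + later)
      ≈⟨ +-congˡ (-‿cong W[1+r]≈W[r]+later) ⟨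
    two * W r - W (ℤ.suc r) ∎
    where
    later oldest : Carrier
    later = Σ< m (λ t → W (r -ℤ + suc t))
    oldest = W (r -ℤ + suc m)
    first : ∀ r → (+ 1 +ℤ r) -ℤ + 1 ≡ r
    first = solve-∀
    shifted : ∀ r t → (+ 1 +ℤ r) -ℤ (+ 1 +ℤ (+ 1 +ℤ t)) ≡ r -ℤ (+ 1 +ℤ t)
    shifted = solve-∀
    W[1+r]≈W[r]+later : W (ℤ.suc r) ≈ W r + later
    W[1+r]≈W[r]+later = trans (fib (ℤ.suc r)) (trans (Σ<-suc m _)
      (+-cong (reflexive (≡.cong W (first r))) (Σ<-cong m (λ t → reflexive (≡.cong W (shifted r (+ t)))))))

  module Powers (x xinv : Carrier) (x*xinv≈1 : x * xinv ≈ 1#) where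
    zpow-suc : ∀ z → zpow x xinv (ℤ.suc z) ≈ x * zpow x xinv z
    zpow-suc (+ a) = refl
    zpow-suc -[1+ zero ] = sym (trans (*-congˡ (*-identityʳ xinv)) x*xinv≈1)
    zpow-suc -[1+ suc a ] = sym (trans (sym (*-assoc _ _ _)) (trans (*-congʳ x*xinv≈1) (*-identityˡ _)))

    zpow-+ : ∀ m z → x ^ m * zpow x xinv z ≈ zpow x xinv (+ m +ℤ z)
    zpow-+ zero z = trans (*-identityˡ _) (reflexive (≡.cong (zpow x xinv) (≡.sym (ℤ.+-identityˡ z))))
    zpow-+ (suc m) z = begin
      x * x ^ m * zpow x xinv z            ≈⟨ *-assoc _ _ _ ⟩
      x * (x ^ m * zpow x xinv z)          ≈⟨ *-congˡ (zpow-+ m z) ⟩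
      x * zpow x xinv (+ m +ℤ z)           ≈⟨ zpow-suc (+ m +ℤ z) ⟨
      zpow x xinv (ℤ.suc (+ m +ℤ z))       ≡⟨ ≡.cong (zpow x xinv) (ℤ.+-assoc (+ 1) (+ m) z) ⟨
      zpow x xinv (+ suc m +ℤ z)           ∎

  module Identity (m : ℕ) (W : ℤ → Carrier) (fib : IsGenFib (suc m) W)
                  (x xinv : Carrier) (x*xinv≈1 : x * xinv ≈ 1#) where
    open Powers x xinv x*xinv≈1

    n : ℕ
    n = suc m

    P A N : Carrier
    P = x ^ suc n
    A = 1# - two * x + P
    N = Σ< (suc n) (λ t → (xinv ^ suc t) * W (-ℤ (+ suc t)))

    h : ℤ → Carrier
    h z = zpow x xinv z * W z

    rhs : ℤ → Carrier
    rhs k = two * W -[1+ 0 ] - two * zpow x xinv (ℤ.suc k) * W k + P * window (suc n) h (k -ℤ + n) - P * N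

    rhs-[-1] : rhs -[1+ 0 ] ≈ 0#
    rhs-[-1] = begin
      two * W₋₁ - two * 1# * W₋₁ + P * window (suc n) h -[1+ n ] - P * N
        ≈⟨ +-congʳ (+-congˡ (*-congˡ (Σ<-negatives≈window n h))) ⟨
      two * W₋₁ - two * 1# * W₋₁ + P * N - P * N
        ≈⟨ solve 3 (λ w p s → con (+ 2) :* w :- con (+ 2) :* con (+ 1) :* w :+ p :* s :- p :* s := con (+ 0))
                   refl W₋₁ P N ⟩
      0# ∎
      where
      W₋₁ : Carrier
      W₋₁ = W -[1+ 0 ]

    window-step : ∀ k → window (suc n) h (ℤ.suc k -ℤ + n)
                        ≈ window (suc n) h (k -ℤ + n) + h (ℤ.suc k) - h (k -ℤ + n)
    window-step k = begin
      window (suc n) h (ℤ.suc k -ℤ + n)               ≡⟨ ≡.cong (window (suc n) h) (base k (+ n)) ⟩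
      window (suc n) h (ℤ.suc (k -ℤ + n))              ≈⟨ window-slide n h (k -ℤ + n) ⟩
      G + h (ℤ.suc (k -ℤ + n) +ℤ + n) - h (k -ℤ + n)  ≡⟨ ≡.cong (λ j → G + h j - h (k -ℤ + n)) (top k (+ n)) ⟩
      G + h (ℤ.suc k) - h (k -ℤ + n)                  ∎
      where
      G : Carrier
      G = window (suc n) h (k -ℤ + n)
      base : ∀ k n → (+ 1 +ℤ k) -ℤ n ≡ + 1 +ℤ (k -ℤ n)
      base = solve-∀
      top : ∀ k n → (+ 1 +ℤ (k -ℤ n)) +ℤ n ≡ + 1 +ℤ k
      top = solve-∀

    P*zpow[k-n]≈zpow[1+k] : ∀ k → P * zpow x xinv (k -ℤ + n) ≈ zpow x xinv (ℤ.suc k)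
    P*zpow[k-n]≈zpow[1+k] k = trans (zpow-+ (suc n) (k -ℤ + n)) (reflexive (≡.cong (zpow x xinv) (lag (+ n) k)))
      where
      lag : ∀ n k → (+ 1 +ℤ n) +ℤ (k -ℤ n) ≡ + 1 +ℤ k
      lag = solve-∀

    rhs-suc : ∀ k → rhs (ℤ.suc k) ≈ rhs k + A * h (ℤ.suc k)
    rhs-suc k = begin
      rhs (ℤ.suc k)
        ≈⟨ +-congʳ (+-cong (+-congˡ (-‿cong (*-congʳ (*-congˡ (zpow-suc (ℤ.suc k)))))) (*-congˡ (window-step k))) ⟩
      two * W₋₁ - two * (x * z) * w₁ + P * (G + z * w₁ - zₗ * wₗ) - P * N
        ≈⟨ solve 9 (λ w₋₁ x z w₁ p g zₗ wₗ n′ →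
             con (+ 2) :* w₋₁ :- con (+ 2) :* (x :* z) :* w₁ :+ p :* (g :+ z :* w₁ :- zₗ :* wₗ) :- p :* n′
             := con (+ 2) :* w₋₁ :- con (+ 2) :* (x :* z) :* w₁ :+ p :* g :+ p :* (z :* w₁)
                  :- p :* zₗ :* wₗ :- p :* n′)
             refl W₋₁ x z w₁ P G zₗ wₗ N ⟩
      two * W₋₁ - two * (x * z) * w₁ + P * G + P * (z * w₁) - P * zₗ * wₗ - P * N
        ≈⟨ +-congʳ (+-congˡ (-‿cong (*-cong (P*zpow[k-n]≈zpow[1+k] k) (IsGenFib⇒W[r-n]≈2W[r]-W[1+r] m fib k)))) ⟩
      two * W₋₁ - two * (x * z) * w₁ + P * G + P * (z * w₁) - z * (two * w₀ - w₁) - P * N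
        ≈⟨ solve 8 (λ w₋₁ x z w₁ p g w₀ n′ →
             con (+ 2) :* w₋₁ :- con (+ 2) :* (x :* z) :* w₁ :+ p :* g :+ p :* (z :* w₁)
               :- z :* (con (+ 2) :* w₀ :- w₁) :- p :* n′
             := con (+ 2) :* w₋₁ :- con (+ 2) :* z :* w₀ :+ p :* g :- p :* n′
               :+ (con (+ 1) :- con (+ 2) :* x :+ p) :* (z :* w₁))
             refl W₋₁ x z w₁ P G w₀ N ⟩
      rhs k + A * h (ℤ.suc k) ∎
      where
      W₋₁ z w₀ w₁ G zₗ wₗ : Carrier
      W₋₁ = W -[1+ 0 ]
      z = zpow x xinv (ℤ.suc k)
      w₀ = W k
      w₁ = W (ℤ.suc k)
      G = window (suc n) h (k -ℤ + n)
      zₗ = zpow x xinv (k -ℤ + n)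
      wₗ = W (k -ℤ + n)

    A*Σ≈rhs : ∀ k → A * Σ< (suc k) (λ j → (x ^ j) * W (+ j)) ≈ rhs (+ k)
    A*Σ≈rhs k = trans (Σ<-distribˡ (suc k) A _) (Σ<-telescope rhs (λ j → A * h j) rhs-[-1] rhs-suc k)

-- The identity already holds for n = 1; the hypothesis 2 ≤ n only excludes n = 0.
theorem12 : ∀ {c ℓ} (R : CommutativeRing c ℓ) →
    let open CommutativeRing R in
    let open Fib R in
    (n : ℕ) → 2 ≤ n →
    (W : ℤ → Carrier) → IsGenFib n W →
    (k : ℕ) → (x xinv : Carrier) → x * xinv ≈ 1# →
    let two = 1# + 1# in
    (1# - two * x + x ^ suc n) * Σ< (suc k) (λ j → (x ^ j) * W (+ j))
      ≈ two * W (-[1+ 0 ])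
        - two * (x ^ suc k) * W (+ k)
        + (x ^ suc n) * Σ< (suc n) (λ t → zpow x xinv ((+ k -ℤ + n) +ℤ + t) * W ((+ k -ℤ + n) +ℤ + t))
        - (x ^ suc n) * Σ< (suc n) (λ t → (xinv ^ suc t) * W (-ℤ (+ suc t)))
theorem12 R zero ()
theorem12 R (suc m) _ W fib k x xinv x*xinv≈1 = Identity.A*Σ≈rhs R m W fib x xinv x*xinv≈1 k
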